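{- The approximation ratio of the 2-Opt heuristic on the metric TSP is at least $\sqrt{n/2}$: for infinitely many $n$ (namely every $n=2k^2$ with $k$ a positive integer) there exists a metric TSP instance with $n$ cities containing a 2-optimal tour whose length is exactly $\sqrt{n/2}$ times the length of a shortest tour.
   Context: A metric TSP instance consists of a complete undirected graph $G$ on $n$ vertices and a function $c:E(G)\to\mathbb{R}_{\ge 0}$ with $c(x,y)+c(y,z)\ge c(x,z)$ for all vertices $x,y,z$. A tour is a cycle containing all vertices of $G$, regarded as an oriented cycle; its length is $c(T)=\sum_{e\in E(T)}c(e)$. For two directed edges $(a,b)$ and $(x,y)$ of a tour $T$, the 2-change replaces them by $(a,x)$ and $(b,y)$ (reversing the segment between $b$ and $x$); it is improving if $c(a,x)+c(b,y)<c(a,b)+c(x,y)$. A tour is 2-optimal if it admits no improving 2-change; the 2-Opt heuristic starts from an arbitrary tour and performs improving 2-changes until the tour is 2-optimal. -}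

module Defs where

open import Data.Nat using (ℕ; zero; suc)
open import Data.Nat.DivMod using (_mod_)
open import Data.Fin using (Fin; toℕ)
open import Data.Fin.Permutation using (Permutation′; _⟨$⟩ʳ_)
open import Data.List using (List; foldr; map; allFin)
open import Data.Rational using (ℚ; 0ℚ; _+_; _≤_; _<_)
open import Relation.Binary.PropositionalEquality using (_≡_; _≢_)

-- A metric TSP instance on n cities (vertices Fin n): a cost function
-- which is nonnegative, symmetric, satisfies the triangle inequality,
-- and (by convention, for the unused diagonal) vanishes on x = x.
record MetricInstance (n : ℕ) : Set where
  field
    cost     : Fin n → Fin n → ℚ
    nonneg   : ∀ x y → 0ℚ ≤ cost x y
    diag     : ∀ x → cost x x ≡ 0ℚ
    symm     : ∀ x y → cost x y ≡ cost y x
    triangle : ∀ x y z → cost x z ≤ cost x y + cost y z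
open MetricInstance public

-- A tour = oriented Hamiltonian cycle, given by a cyclic ordering
-- π(0), π(1), ..., π(n-1) of all the vertices; its directed edges are
-- (π(i), π(i+1 mod n)).
Tour : ℕ → Set
Tour n = Permutation′ n

next : ∀ {n} → Fin n → Fin n
next {suc m} i = suc (toℕ i) mod suc m

Σℚ : ∀ {n} → (Fin n → ℚ) → ℚ
Σℚ {n} f = foldr _+_ 0ℚ (map f (allFin n))

tourLength : ∀ {n} → MetricInstance n → Tour n → ℚ
tourLength I T = Σℚ (λ i → cost I (T ⟨$⟩ʳ i) (T ⟨$⟩ʳ next i))

-- The 2-change of the directed tour edges (a,b) = (T i, T (i+1)) and
-- (x,y) = (T j, T (j+1)) (distinct edges, i ≠ j) replaces them by (a,x),(b,y);
-- it is improving iff c(a,x) + c(b,y) < c(a,b) + c(x,y).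
ImprovingTwoChange : ∀ {n} → MetricInstance n → Tour n → Fin n → Fin n → Set
ImprovingTwoChange I T i j =
  cost I a x + cost I b y < cost I a b + cost I x y
  where
    a = T ⟨$⟩ʳ i
    b = T ⟨$⟩ʳ next i
    x = T ⟨$⟩ʳ j
    y = T ⟨$⟩ʳ next j

TwoOptimal : ∀ {n} → MetricInstance n → Tour n → Set
TwoOptimal I T = ∀ i j → i ≢ j → ImprovingTwoChange I T i j → Data.Empty.⊥
  where import Data.Empty

Optimal : ∀ {n} → MetricInstance n → Tour n → Set
Optimal I T = ∀ T′ → tourLength I T ≤ tourLength I T′

-- For k ≥ 1 and n = 2k², split the cities 0, …, n-1 into 2k blocks of k
-- consecutive cities, and let two cities be at the parity distance of their blocks:
-- 0 within a block, 1 between blocks of different parity, 2 between different blocks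
-- of equal parity.  Such instances are pullbacks of a pseudometric on ℕ.
--  * A closed walk that visits and leaves each of 2k points, under a distance that
--    separates points, has length ≥ 2k: it must enter every point, and a step enters
--    at most one (walkLength-lowerBound).  The sorted tour changes block exactly 2k
--    times, so it is a shortest tour, of length 2k.
--  * The zig-zag tour alternates between even and odd blocks and traverses every
--    ordered pair of blocks of different parity exactly once.  All its n edges cost 1,
--    so its length is n = k · 2k, and a 2-change replacing two of its edges costs at
--    least 2 (parityDist-noShortcut), so it is 2-optimal.

module Submission where

open import Defs
open import Data.Nat using (ℕ; suc; _*_; _≤_)
open import Data.Product using (Σ; _×_)
open import Data.Rational using (ℚ)
open import Relation.Binary.PropositionalEquality using (_≡_)
import Data.Rational as Q
open import Data.Integer using (+_)

open import Data.Nat using (zero; _+_; _<_; z≤n; s≤s; _≟_; NonZero; parity)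
import Data.Nat.Properties as ℕP
open import Algebra.Properties.CommutativeSemigroup ℕP.+-commutativeSemigroup
  using () renaming (interchange to +-interchange)
import Data.Integer as ℤ
import Data.Integer.Properties as ℤP
import Data.Rational.Properties as QP
open import Data.Rational.Unnormalised as ℚᵘ using (mkℚᵘ; *≡*; *≤*; *<*)
import Data.Rational.Unnormalised.Properties as ℚᵘP
open import Data.Fin using (Fin; toℕ; fromℕ<)
import Data.Fin.Properties as FinP
open import Data.Fin.Permutation using (_⟨$⟩ʳ_; _⟨$⟩ˡ_; inverseʳ; permutation)
  renaming (id to sortedTour)
open import Data.Nat.DivMod using (_mod_; _%_; _/_)
import Data.Nat.DivMod as DivMod
open import Data.Nat.Divisibility using (divides)
open import Data.List using (foldr; tabulate; allFin)
import Data.List.Properties as ListP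
open import Data.Product using (_,_; ∃-syntax; proj₁; proj₂)
open import Function using (_∘_)
open import Relation.Binary.PropositionalEquality
  using (refl; sym; trans; cong; cong₂; subst; subst₂; _≢_; module ≡-Reasoning)
open import Relation.Nullary using (¬_; Dec; yes; no)
open import Data.Empty using (⊥-elim)
open import Data.Sum using (inj₁; inj₂)
open import Data.Parity.Base using (Parity; 0ℙ; 1ℙ; _⁻¹)
import Data.Parity.Base as ℙ
import Data.Parity.Properties as ℙP

-- The embedding ℕ → ℚ, n ↦ n / 1 (the form in which the statement writes k);
-- it preserves +, * and the orders, which lets all lengths be computed in ℕ.
ι : ℕ → ℚ
ι m = + m Q./ 1

ι-toℚᵘ : ∀ m → Q.toℚᵘ (ι m) ℚᵘ.≃ mkℚᵘ (+ m) 0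
ι-toℚᵘ m = QP.toℚᵘ-fromℚᵘ (mkℚᵘ (+ m) 0)

ι-+ : ∀ a b → ι (a + b) ≡ ι a Q.+ ι b
ι-+ a b = QP.toℚᵘ-injective (begin
    Q.toℚᵘ (ι (a + b))                 ≈⟨ ι-toℚᵘ (a + b) ⟩
    mkℚᵘ (+ (a + b)) 0                 ≈⟨ *≡* (cong (ℤ._* + 1) eq) ⟩
    mkℚᵘ (+ a) 0 ℚᵘ.+ mkℚᵘ (+ b) 0     ≈⟨ ℚᵘP.+-cong (ι-toℚᵘ a) (ι-toℚᵘ b) ⟨
    Q.toℚᵘ (ι a) ℚᵘ.+ Q.toℚᵘ (ι b)     ≈⟨ QP.toℚᵘ-homo-+ (ι a) (ι b) ⟨
    Q.toℚᵘ (ι a Q.+ ι b)               ∎)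
  where
  open ℚᵘP.≃-Reasoning
  eq : + (a + b) ≡ + a ℤ.* + 1 ℤ.+ + b ℤ.* + 1
  eq = trans (ℤP.pos-+ a b) (sym (cong₂ ℤ._+_ (ℤP.*-identityʳ (+ a)) (ℤP.*-identityʳ (+ b))))

ι-* : ∀ a b → ι (a * b) ≡ ι a Q.* ι b
ι-* a b = QP.toℚᵘ-injective (begin
    Q.toℚᵘ (ι (a * b))                 ≈⟨ ι-toℚᵘ (a * b) ⟩
    mkℚᵘ (+ (a * b)) 0                 ≈⟨ *≡* (cong (ℤ._* + 1) (ℤP.pos-* a b)) ⟩
    mkℚᵘ (+ a) 0 ℚᵘ.* mkℚᵘ (+ b) 0     ≈⟨ ℚᵘP.*-cong (ι-toℚᵘ a) (ι-toℚᵘ b) ⟨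
    Q.toℚᵘ (ι a) ℚᵘ.* Q.toℚᵘ (ι b)     ≈⟨ QP.toℚᵘ-homo-* (ι a) (ι b) ⟨
    Q.toℚᵘ (ι a Q.* ι b)               ∎)
  where open ℚᵘP.≃-Reasoning

ι-mono-≤ : ∀ {a b} → a ≤ b → ι a Q.≤ ι b
ι-mono-≤ {a} {b} a≤b = QP.toℚᵘ-cancel-≤
  (ℚᵘP.≤-respʳ-≃ (ℚᵘP.≃-sym (ι-toℚᵘ b)) (ℚᵘP.≤-respˡ-≃ (ℚᵘP.≃-sym (ι-toℚᵘ a))
    (*≤* (ℤP.*-monoʳ-≤-nonNeg (+ 1) (ℤ.+≤+ a≤b)))))

ι-mono-< : ∀ {a b} → a < b → ι a Q.< ι b
ι-mono-< {a} {b} a<b = QP.toℚᵘ-cancel-<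
  (ℚᵘP.<-respʳ-≃ (ℚᵘP.≃-sym (ι-toℚᵘ b)) (ℚᵘP.<-respˡ-≃ (ℚᵘP.≃-sym (ι-toℚᵘ a))
    (*<* (ℤP.*-monoʳ-<-pos (+ 1) (ℤ.+<+ a<b)))))

-- Finite sums of natural numbers: sumBelow n g = g 0 + g 1 + ⋯ + g (n ∸ 1).
-- Tour lengths are computed as such sums and only then embedded in ℚ.
sumBelow : ℕ → (ℕ → ℕ) → ℕ
sumBelow zero    g = 0
sumBelow (suc n) g = g 0 + sumBelow n (g ∘ suc)

sumBelow-cong : ∀ n {g h : ℕ → ℕ} → (∀ m → m < n → g m ≡ h m) → sumBelow n g ≡ sumBelow n h
sumBelow-cong zero    eq = refl
sumBelow-cong (suc n) eq = cong₂ _+_ (eq 0 (s≤s z≤n)) (sumBelow-cong n (λ m m<n → eq (suc m) (s≤s m<n)))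

sumBelow-mono : ∀ n {g h : ℕ → ℕ} → (∀ m → m < n → g m ≤ h m) → sumBelow n g ≤ sumBelow n h
sumBelow-mono zero    le = z≤n
sumBelow-mono (suc n) le = ℕP.+-mono-≤ (le 0 (s≤s z≤n)) (sumBelow-mono n (λ m m<n → le (suc m) (s≤s m<n)))

sumBelow-const : ∀ n c → sumBelow n (λ _ → c) ≡ n * c
sumBelow-const zero    c = refl
sumBelow-const (suc n) c = cong (_+_ c) (sumBelow-const n c)

sumBelow-+ : ∀ n (g h : ℕ → ℕ) → sumBelow n (λ m → g m + h m) ≡ sumBelow n g + sumBelow n h
sumBelow-+ zero    g h = refl
sumBelow-+ (suc n) g h = trans (cong (_+_ (g 0 + h 0)) (sumBelow-+ n (g ∘ suc) (h ∘ suc)))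
                               (+-interchange (g 0) (h 0) _ _)

sumBelow-swap : ∀ a b (G : ℕ → ℕ → ℕ) →
  sumBelow a (λ i → sumBelow b (G i)) ≡ sumBelow b (λ j → sumBelow a (λ i → G i j))
sumBelow-swap zero    b G = sym (trans (sumBelow-const b 0) (ℕP.*-zeroʳ b))
sumBelow-swap (suc a) b G = trans (cong (_+_ (sumBelow b (G 0))) (sumBelow-swap a b (G ∘ suc)))
                                  (sym (sumBelow-+ b (G 0) _))

sumBelow-term : ∀ n (g : ℕ → ℕ) m → m < n → g m ≤ sumBelow n g
sumBelow-term (suc n) g zero    _         = ℕP.m≤m+n (g 0) _
sumBelow-term (suc n) g (suc m) (s≤s m<n) = ℕP.≤-trans (sumBelow-term n (g ∘ suc) m m<n) (ℕP.m≤n+m _ (g 0))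

sumBelow-split : ∀ a b (g : ℕ → ℕ) → sumBelow (a + b) g ≡ sumBelow a g + sumBelow b (λ m → g (a + m))
sumBelow-split zero    b g = refl
sumBelow-split (suc a) b g = trans (cong (_+_ (g 0)) (sumBelow-split a b (g ∘ suc))) (sym (ℕP.+-assoc (g 0) _ _))

sumBelow-last : ∀ n (g : ℕ → ℕ) → sumBelow (suc n) g ≡ sumBelow n g + g n
sumBelow-last zero    g = ℕP.+-comm (g 0) 0
sumBelow-last (suc n) g = trans (cong (_+_ (g 0)) (sumBelow-last n (g ∘ suc))) (sym (ℕP.+-assoc (g 0) _ _))

sumBelow-blocks : ∀ a c (g : ℕ → ℕ) → sumBelow (a * c) g ≡ sumBelow a (λ b → sumBelow c (λ y → g (b * c + y)))
sumBelow-blocks zero    c g = refl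
sumBelow-blocks (suc a) c g = trans (sumBelow-split c (a * c) g) (cong (_+_ (sumBelow c g))
  (trans (sumBelow-blocks a c (λ m → g (c + m)))
         (sumBelow-cong a (λ b _ → sumBelow-cong c (λ y _ → cong g (sym (ℕP.+-assoc c (b * c) y)))))))

Σℚ-ι : ∀ n (g : ℕ → ℕ) → Σℚ {n} (λ i → ι (g (toℕ i))) ≡ ι (sumBelow n g)
Σℚ-ι n g = trans (cong (foldr Q._+_ Q.0ℚ) (ListP.map-tabulate {n = n} (λ i → i) (λ i → ι (g (toℕ i))))) (tabulated n g)
  where
  tabulated : ∀ n (g : ℕ → ℕ) → foldr Q._+_ Q.0ℚ (tabulate {n = n} (λ i → ι (g (toℕ i)))) ≡ ι (sumBelow n g)
  tabulated zero    g = refl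
  tabulated (suc n) g = trans (cong (ι (g 0) Q.+_) (tabulated n (g ∘ suc))) (sym (ι-+ (g 0) _))

parity-suc : ∀ m → parity (suc m) ≡ parity m ⁻¹
parity-suc m = trans (sym (ℙP.⁻¹-involutive _)) (cong _⁻¹ (ℙP.suc-homo-⁻¹ m))

parity-+even : ∀ t x d → parity d ≡ 0ℙ → parity (t + x * d) ≡ parity t
parity-+even t x d even = begin
  parity (t + x * d)                      ≡⟨ ℙP.+-homo-+ t (x * d) ⟩
  parity t ℙ.+ parity (x * d)             ≡⟨ cong (parity t ℙ.+_) (ℙP.*-homo-* x d) ⟩
  parity t ℙ.+ (parity x ℙ.* parity d)    ≡⟨ cong (λ e → parity t ℙ.+ (parity x ℙ.* e)) even ⟩
  parity t ℙ.+ (parity x ℙ.* 0ℙ)          ≡⟨ cong (parity t ℙ.+_) (ℙP.*-zeroʳ (parity x)) ⟩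
  parity t ℙ.+ 0ℙ                         ≡⟨ ℙP.+-identityʳ (parity t) ⟩
  parity t                                ∎
  where open ≡-Reasoning

parity-%-even : ∀ m d .{{_ : NonZero d}} → parity d ≡ 0ℙ → parity (m % d) ≡ parity m
parity-%-even m d even =
  trans (sym (parity-+even (m % d) (m / d) d even)) (cong parity (sym (DivMod.m≡m%n+[m/n]*n m d)))

≢⇒⁻¹ : ∀ {p q : Parity} → p ≢ q → q ≡ p ⁻¹
≢⇒⁻¹ {0ℙ} {0ℙ} p≢q = ⊥-elim (p≢q refl)
≢⇒⁻¹ {0ℙ} {1ℙ} _   = refl
≢⇒⁻¹ {1ℙ} {0ℙ} _   = refl
≢⇒⁻¹ {1ℙ} {1ℙ} p≢q = ⊥-elim (p≢q refl)

parityDist : ℕ → ℕ → ℕ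
parityDist a b with a ≟ b
... | yes _ = 0
... | no _ with parity a ℙP.≟ parity b
...   | yes _ = 2
...   | no _  = 1

parityDist-refl : ∀ a → parityDist a a ≡ 0
parityDist-refl a with a ≟ a
... | yes _   = refl
... | no a≢a = ⊥-elim (a≢a refl)

parityDist-alternating : ∀ {a b} → parity b ≡ parity a ⁻¹ → parityDist a b ≡ 1
parityDist-alternating {a} {b} alt with a ≟ b
... | yes refl = ⊥-elim (ℙP.p≢p⁻¹ (parity a) alt)
... | no _ with parity a ℙP.≟ parity b
...   | yes same = ⊥-elim (ℙP.p≢p⁻¹ (parity a) (trans same alt))
...   | no _     = refl

parityDist-sameParity : ∀ {a b} → a ≢ b → parity a ≡ parity b → parityDist a b ≡ 2
parityDist-sameParity {a} {b} a≢b same with a ≟ b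
... | yes a≡b = ⊥-elim (a≢b a≡b)
... | no _ with parity a ℙP.≟ parity b
...   | yes _    = refl
...   | no diff  = ⊥-elim (diff same)

parityDist-sym : ∀ a b → parityDist a b ≡ parityDist b a
parityDist-sym a b = byCases (a ≟ b) (parity a ℙP.≟ parity b)
  where
  byCases : Dec (a ≡ b) → Dec (parity a ≡ parity b) → parityDist a b ≡ parityDist b a
  byCases (yes refl) _          = refl
  byCases (no a≢b)   (yes same) = trans (parityDist-sameParity {a} {b} a≢b same)
                                        (sym (parityDist-sameParity {b} {a} (a≢b ∘ sym) (sym same)))
  byCases (no a≢b)   (no diff)  = trans (parityDist-alternating {a} {b} (≢⇒⁻¹ diff))
                                        (sym (parityDist-alternating {b} {a} (≢⇒⁻¹ (diff ∘ sym))))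

parityDist-≤2 : ∀ a b → parityDist a b ≤ 2
parityDist-≤2 a b with a ≟ b
... | yes _ = z≤n
... | no _ with parity a ℙP.≟ parity b
...   | yes _ = ℕP.≤-refl
...   | no _  = s≤s z≤n

parityDist-separates : ∀ {a b} → a ≢ b → 1 ≤ parityDist a b
parityDist-separates {a} {b} a≢b with a ≟ b
... | yes a≡b = ⊥-elim (a≢b a≡b)
... | no _ with parity a ℙP.≟ parity b
...   | yes _ = s≤s z≤n
...   | no _  = s≤s z≤n

-- Triangle inequality: if a ≠ c and b differs from both, the right side is ≥ 1 + 1.
parityDist-triangle : ∀ a b c → parityDist a c ≤ parityDist a b + parityDist b c
parityDist-triangle a b c = byCases (a ≟ c) (b ≟ a) (b ≟ c)
  where
  byCases : Dec (a ≡ c) → Dec (b ≡ a) → Dec (b ≡ c) → parityDist a c ≤ parityDist a b + parityDist b c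
  byCases (yes refl) _          _          = ℕP.≤-trans (ℕP.≤-reflexive (parityDist-refl a)) z≤n
  byCases (no _)     (yes refl) _          = ℕP.m≤n+m _ (parityDist b b)
  byCases (no _)     (no _)     (yes refl) = ℕP.m≤m+n _ (parityDist b b)
  byCases (no _)     (no b≢a)   (no b≢c)   = ℕP.≤-trans (parityDist-≤2 a c)
    (ℕP.+-mono-≤ (parityDist-separates {a} {b} (b≢a ∘ sym)) (parityDist-separates {b} {c} b≢c))

-- The local fact behind 2-optimality: if x → x′ and y → y′ are two different
-- parity-changing steps, reconnecting them as x–y and x′–y′ costs at least 2.
parityDist-noShortcut : ∀ {x x′ y y′} → parity x′ ≡ parity x ⁻¹ → parity y′ ≡ parity y ⁻¹ →
  ¬ (x ≡ y × x′ ≡ y′) → 2 ≤ parityDist x y + parityDist x′ y′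
parityDist-noShortcut {x} {x′} {y} {y′} altx alty different = byCases (x ≟ y) (parity x ℙP.≟ parity y)
  where
  byCases : Dec (x ≡ y) → Dec (parity x ≡ parity y) → 2 ≤ parityDist x y + parityDist x′ y′
  byCases (yes refl) _ = ℕP.≤-reflexive (sym (cong₂ _+_ (parityDist-refl x)
    (parityDist-sameParity {x′} {y′} (λ x′≡y′ → different (refl , x′≡y′)) (trans altx (sym alty)))))
  byCases (no x≢y) (yes same) =
    ℕP.≤-trans (ℕP.≤-reflexive (sym (parityDist-sameParity {x} {y} x≢y same))) (ℕP.m≤m+n _ _)
  byCases (no x≢y) (no diff) = ℕP.≤-reflexive (sym (cong₂ _+_
    (parityDist-alternating {x} {y} (≢⇒⁻¹ diff))
    (parityDist-alternating {x′} {y′} (trans alty (cong _⁻¹ (trans (≢⇒⁻¹ diff) (sym altx)))))))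

record Pseudometricℕ : Set where
  field
    δ          : ℕ → ℕ → ℕ
    δ-refl     : ∀ a → δ a a ≡ 0
    δ-sym      : ∀ a b → δ a b ≡ δ b a
    δ-triangle : ∀ a b c → δ a c ≤ δ a b + δ b c
open Pseudometricℕ

parityMetric : Pseudometricℕ
parityMetric = record
  { δ = parityDist ; δ-refl = parityDist-refl ; δ-sym = parityDist-sym ; δ-triangle = parityDist-triangle }

pullback : ∀ {n} → Pseudometricℕ → (Fin n → ℕ) → MetricInstance n
pullback M ℓ = record
  { cost     = λ x y → ι (δ M (ℓ x) (ℓ y))
  ; nonneg   = λ x y → ι-mono-≤ {0} {δ M (ℓ x) (ℓ y)} z≤n
  ; diag     = λ x → cong ι (δ-refl M (ℓ x))
  ; symm     = λ x y → cong ι (δ-sym M (ℓ x) (ℓ y))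
  ; triangle = λ x y z → subst (ι (δ M (ℓ x) (ℓ z)) Q.≤_) (ι-+ (δ M (ℓ x) (ℓ y)) (δ M (ℓ y) (ℓ z)))
                                (ι-mono-≤ (δ-triangle M (ℓ x) (ℓ y) (ℓ z)))
  }

walkLength : (ℕ → ℕ → ℕ) → (ℕ → ℕ) → ℕ → ℕ
walkLength δ F n = sumBelow n (λ m → δ (F m) (F (suc m)))

tourWalk : ∀ {n} → (Fin (suc n) → ℕ) → Tour (suc n) → ℕ → ℕ
tourWalk {n} ℓ T m = ℓ (T ⟨$⟩ʳ (m mod suc n))

toℕ-mod : ∀ {n} .{{_ : NonZero n}} m → toℕ (m mod n) ≡ m % n
toℕ-mod m = FinP.toℕ-fromℕ< _

mod-toℕ : ∀ {n} .{{_ : NonZero n}} (i : Fin n) → toℕ i mod n ≡ i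
mod-toℕ i = FinP.toℕ-injective (trans (toℕ-mod (toℕ i)) (DivMod.m<n⇒m%n≡m (FinP.toℕ<n i)))

tourLength-pullback : ∀ {n} (M : Pseudometricℕ) (ℓ : Fin (suc n) → ℕ) (T : Tour (suc n)) →
  tourLength (pullback M ℓ) T ≡ ι (walkLength (δ M) (tourWalk ℓ T) (suc n))
tourLength-pullback {n} M ℓ T = trans
  (cong (foldr Q._+_ Q.0ℚ) (ListP.map-cong (λ i → cong (λ j → edge j (next i)) (sym (mod-toℕ i))) (allFin (suc n))))
  (Σℚ-ι (suc n) (λ m → δ M (tourWalk ℓ T m) (tourWalk ℓ T (suc m))))
  where
  edge : Fin (suc n) → Fin (suc n) → ℚ
  edge i j = ι (δ M (ℓ (T ⟨$⟩ʳ i)) (ℓ (T ⟨$⟩ʳ j)))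

enters : ℕ → ℕ → ℕ → ℕ
enters b x y with x ≟ b | y ≟ b
... | no _ | yes _ = 1
... | _    | _     = 0

enters-stay : ∀ b x → enters b x x ≡ 0
enters-stay b x with x ≟ b
... | yes _ = refl
... | no _  = refl

enters-hit : ∀ {b x y} → x ≢ b → y ≡ b → enters b x y ≡ 1
enters-hit {b} {x} {y} x≢b y≡b with x ≟ b | y ≟ b
... | yes x≡b | _       = ⊥-elim (x≢b x≡b)
... | no _    | yes _   = refl
... | no _    | no y≢b  = ⊥-elim (y≢b y≡b)

isAt : ℕ → ℕ → ℕ
isAt y b with y ≟ b
... | yes _ = 1
... | no _  = 0

sumBelow-isAt : ∀ K y → sumBelow K (isAt y) ≤ 1
sumBelow-isAt zero    y       = z≤n
sumBelow-isAt (suc K) zero    = ℕP.≤-reflexive (cong (_+_ 1)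
  (trans (sumBelow-cong K (λ _ _ → refl)) (trans (sumBelow-const K 0) (ℕP.*-zeroʳ K))))
sumBelow-isAt (suc K) (suc y) = ℕP.≤-trans (ℕP.≤-reflexive (sumBelow-cong K (λ b _ → shift b))) (sumBelow-isAt K y)
  where
  shift : ∀ b → isAt (suc y) (suc b) ≡ isAt y b
  shift b with suc y ≟ suc b | y ≟ b
  ... | yes _     | yes _   = refl
  ... | no _      | no _    = refl
  ... | yes sy≡sb | no y≢b  = ⊥-elim (y≢b (ℕP.suc-injective sy≡sb))
  ... | no sy≢sb  | yes y≡b = ⊥-elim (sy≢sb (cong suc y≡b))

enters≤isAt : ∀ b x y → enters b x y ≤ isAt y b
enters≤isAt b x y with x ≟ b | y ≟ b
... | no _  | yes _ = ℕP.≤-refl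
... | no _  | no _  = z≤n
... | yes _ | _     = z≤n

sumBelow-enters : ∀ (δ : ℕ → ℕ → ℕ) → (∀ {a b} → a ≢ b → 1 ≤ δ a b) →
  ∀ K x y → sumBelow K (λ b → enters b x y) ≤ δ x y
sumBelow-enters δ separates K x y with x ≟ y
... | yes refl = ℕP.≤-trans (ℕP.≤-reflexive (trans (sumBelow-cong K (λ b _ → enters-stay b x))
                                                    (trans (sumBelow-const K 0) (ℕP.*-zeroʳ K)))) z≤n
... | no x≢y   = ℕP.≤-trans (sumBelow-mono K (λ b _ → enters≤isAt b x y))
                            (ℕP.≤-trans (sumBelow-isAt K y) (separates x≢y))

firstEntry : ∀ (F : ℕ → ℕ) b {a} c → a ≤ c → F a ≢ b → F c ≡ b →
  ∃[ m ] m < c × F m ≢ b × F (suc m) ≡ b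
firstEntry F b zero    z≤n Fa≢b Fc≡b = ⊥-elim (Fa≢b Fc≡b)
firstEntry F b (suc c) a≤c Fa≢b Fc≡b with F c ≟ b | ℕP.m≤n⇒m<n∨m≡n a≤c
... | no Fc≢b | _              = c , ℕP.≤-refl , Fc≢b , Fc≡b
... | yes _   | inj₂ refl      = ⊥-elim (Fa≢b Fc≡b)
... | yes F≡b | inj₁ (s≤s a≤c′) with firstEntry F b c a≤c′ Fa≢b F≡b
...   | m , m<c , entry = m , ℕP.m<n⇒m<1+n m<c , entry

closedWalk-enters : ∀ (F : ℕ → ℕ) b n → F n ≡ F 0 →
  (∃[ p ] p < n × F p ≡ b) → (∃[ r ] r < n × F r ≢ b) →
  ∃[ m ] m < n × enters b (F m) (F (suc m)) ≡ 1
closedWalk-enters F b n closed (p , p<n , Fp≡b) (r , r<n , Fr≢b) with F 0 ≟ b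
... | no F0≢b with firstEntry F b p z≤n F0≢b Fp≡b
...   | m , m<p , Fm≢b , Fm+1≡b = m , ℕP.<-trans m<p p<n , enters-hit Fm≢b Fm+1≡b
closedWalk-enters F b n closed (p , p<n , Fp≡b) (r , r<n , Fr≢b) | yes F0≡b
  with firstEntry F b n (ℕP.<⇒≤ r<n) Fr≢b (trans closed F0≡b)
...   | m , m<n , Fm≢b , Fm+1≡b = m , m<n , enters-hit Fm≢b Fm+1≡b

-- Lower bound for closed walks: if a closed walk of n steps is somewhere at and
-- somewhere away from each of the points 0, …, K-1, it enters each of them, and
-- a step x → y enters at most δ x y of them; so its length is at least K.
walkLength-lowerBound : ∀ (δ : ℕ → ℕ → ℕ) → (∀ {a b} → a ≢ b → 1 ≤ δ a b) →
  ∀ (F : ℕ → ℕ) n K → F n ≡ F 0 →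
  (∀ b → b < K → ∃[ p ] p < n × F p ≡ b) →
  (∀ b → b < K → ∃[ r ] r < n × F r ≢ b) →
  K ≤ walkLength δ F n
walkLength-lowerBound δ separates F n K closed visits avoids = begin
  K                                                        ≡⟨ sym (ℕP.*-identityʳ K) ⟩
  K * 1                                                    ≡⟨ sym (sumBelow-const K 1) ⟩
  sumBelow K (λ _ → 1)                                     ≤⟨ sumBelow-mono K entersOnce ⟩
  sumBelow K (λ b → sumBelow n (λ m → entersAt b m))       ≡⟨ sumBelow-swap K n entersAt ⟩
  sumBelow n (λ m → sumBelow K (λ b → entersAt b m))       ≤⟨ sumBelow-mono n (λ m _ →
                                                                sumBelow-enters δ separates K (F m) (F (suc m))) ⟩
  walkLength δ F n                                         ∎
  where
  open ℕP.≤-Reasoning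
  entersAt : ℕ → ℕ → ℕ
  entersAt b m = enters b (F m) (F (suc m))
  entersOnce : ∀ b → b < K → 1 ≤ sumBelow n (entersAt b)
  entersOnce b b<K with closedWalk-enters F b n closed (visits b b<K) (avoids b b<K)
  ... | m , m<n , entry = subst (_≤ sumBelow n (entersAt b)) entry (sumBelow-term n (entersAt b) m m<n)

digits-< : ∀ {y c a m} → y < c → a < m → y + a * c < m * c
digits-< {y} {c} {a} y<c a<m = ℕP.<-≤-trans (ℕP.+-monoˡ-< (a * c) y<c) (ℕP.*-monoˡ-≤ c a<m)

divMod-unique : ∀ c .{{_ : NonZero c}} {a y} → y < c → (y + a * c) / c ≡ a × (y + a * c) % c ≡ y
divMod-unique c {a} {y} y<c =
  trans (DivMod.+-distrib-/-∣ʳ y (divides a refl)) (cong₂ _+_ (DivMod.m<n⇒m/n≡0 y<c) (DivMod.m*n/n≡m a c)) ,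
  trans (DivMod.[m+kn]%n≡m%n y a c) (DivMod.m<n⇒m%n≡m y<c)

suc-mod-injective : ∀ k′ {x y} → suc x % suc k′ ≡ suc y % suc k′ → x % suc k′ ≡ y % suc k′
suc-mod-injective k′ {x} {y} eq = begin
  x % suc k′                            ≡⟨ shift x ⟩
  (suc x % suc k′ + k′ % suc k′) % suc k′  ≡⟨ cong (λ r → (r + k′ % suc k′) % suc k′) eq ⟩
  (suc y % suc k′ + k′ % suc k′) % suc k′  ≡⟨ shift y ⟨
  y % suc k′                            ∎
  where
  open ≡-Reasoning
  shift : ∀ z → z % suc k′ ≡ (suc z % suc k′ + k′ % suc k′) % suc k′
  shift z = trans (sym (DivMod.[m+n]%n≡m%n z (suc k′)))
                  (trans (cong (_% suc k′) (ℕP.+-suc z k′)) (DivMod.%-distribˡ-+ (suc z) k′ (suc k′)))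

record InverseMapsBelow (n : ℕ) : Set where
  field
    to       : ℕ → ℕ
    from     : ℕ → ℕ
    to-<     : ∀ {p} → p < n → to p < n
    from-<   : ∀ {r} → r < n → from r < n
    from-to  : ∀ {p} → p < n → from (to p) ≡ p
    to-from  : ∀ {r} → r < n → to (from r) ≡ r

module _ {n} (M : InverseMapsBelow n) where
  open InverseMapsBelow M

  private
    to′ from′ : Fin n → Fin n
    to′   i = fromℕ< (to-< (FinP.toℕ<n i))
    from′ i = fromℕ< (from-< (FinP.toℕ<n i))

  toPermutation : Tour n
  toPermutation = permutation to′ from′
    (λ r → FinP.toℕ-injective (trans (FinP.toℕ-fromℕ< _) (trans (cong to (FinP.toℕ-fromℕ< _)) (to-from (FinP.toℕ<n r)))))
    (λ p → FinP.toℕ-injective (trans (FinP.toℕ-fromℕ< _) (trans (cong from (FinP.toℕ-fromℕ< _)) (from-to (FinP.toℕ<n p)))))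

  toPermutation-toℕ : ∀ i → toℕ (toPermutation ⟨$⟩ʳ i) ≡ to (toℕ i)
  toPermutation-toℕ i = FinP.toℕ-fromℕ< _

module Construction (k′ : ℕ) where
  k : ℕ
  k = suc k′

  n : ℕ
  n = 2 * (k * k)

  blocks : ℕ
  blocks = 2 * k

  n≡blocks*k : n ≡ blocks * k
  n≡blocks*k = sym (ℕP.*-assoc 2 k k)

  block : ℕ → ℕ
  block r = r / k

  I : MetricInstance n
  I = pullback parityMetric (block ∘ toℕ)

  walk : Tour n → ℕ → ℕ
  walk = tourWalk (block ∘ toℕ)

  len : Tour n → ℕ
  len T = walkLength parityDist (walk T) n

  tourLength-I : ∀ T → tourLength I T ≡ ι (len T)
  tourLength-I = tourLength-pullback parityMetric (block ∘ toℕ)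

  2≤blocks : 2 ≤ blocks
  2≤blocks = ℕP.*-monoʳ-≤ 2 (s≤s z≤n)

  blocks-even : parity blocks ≡ 0ℙ
  blocks-even = ℙP.*-homo-* 2 k

  block-+* : ∀ {b y} → y < k → block (y + b * k) ≡ b
  block-+* y<k = proj₁ (divMod-unique k y<k)

  walk-closed : ∀ T → walk T n ≡ walk T 0
  walk-closed T = cong (λ i → block (toℕ (T ⟨$⟩ʳ i)))
    (FinP.toℕ-injective (trans (toℕ-mod {n} n) (trans (DivMod.n%n≡0 n) (sym (toℕ-mod {n} 0)))))

  walk-visits : ∀ T b → b < blocks → ∃[ p ] p < n × walk T p ≡ b
  walk-visits T b b<blocks = toℕ (T ⟨$⟩ˡ city) , FinP.toℕ<n _ , (begin
    block (toℕ (T ⟨$⟩ʳ (toℕ (T ⟨$⟩ˡ city) mod n))) ≡⟨ cong (λ i → block (toℕ (T ⟨$⟩ʳ i))) (mod-toℕ (T ⟨$⟩ˡ city)) ⟩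
    block (toℕ (T ⟨$⟩ʳ (T ⟨$⟩ˡ city)))             ≡⟨ cong (block ∘ toℕ) (inverseʳ T) ⟩
    block (toℕ city)                               ≡⟨ cong block (FinP.toℕ-fromℕ< bk<n) ⟩
    block (0 + b * k)                              ≡⟨ block-+* (s≤s z≤n) ⟩
    b                                              ∎)
    where
    open ≡-Reasoning
    bk<n : b * k < n
    bk<n = subst (b * k <_) (sym n≡blocks*k) (ℕP.*-monoˡ-< k b<blocks)
    city : Fin n
    city = fromℕ< bk<n

  walk-avoids : ∀ T b → b < blocks → ∃[ r ] r < n × walk T r ≢ b
  walk-avoids T zero    _ with walk-visits T 1 2≤blocks
  ... | r , r<n , at1 = r , r<n , λ at0 → ℕP.0≢1+n (trans (sym at0) at1)
  walk-avoids T (suc b) _ with walk-visits T 0 (ℕP.<-trans (s≤s z≤n) 2≤blocks)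
  ... | r , r<n , at0 = r , r<n , λ atb → ℕP.0≢1+n (trans (sym at0) atb)

  len-lowerBound : ∀ T → blocks ≤ len T
  len-lowerBound T = walkLength-lowerBound parityDist parityDist-separates
    (walk T) n blocks (walk-closed T) (walk-visits T) (walk-avoids T)

  sortedStep : ℕ → ℕ
  sortedStep m = parityDist (walk sortedTour m) (walk sortedTour (suc m))

  sortedWalk : ∀ {b y} → b < blocks → y < k → walk sortedTour (y + b * k) ≡ b
  sortedWalk {b} {y} b<blocks y<k = begin
    block (toℕ ((y + b * k) mod n)) ≡⟨ cong block (toℕ-mod {n} (y + b * k)) ⟩
    block ((y + b * k) % n)         ≡⟨ cong block (DivMod.m<n⇒m%n≡m y+bk<n) ⟩
    block (y + b * k)               ≡⟨ block-+* y<k ⟩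
    b                               ∎
    where
    open ≡-Reasoning
    y+bk<n : y + b * k < n
    y+bk<n = subst (y + b * k <_) (sym n≡blocks*k) (digits-< y<k b<blocks)

  sortedWalk-boundary : ∀ b → walk sortedTour (suc (k′ + b * k)) ≡ suc b % blocks
  sortedWalk-boundary b = begin
    block (toℕ (suc (k′ + b * k) mod n)) ≡⟨ cong block (toℕ-mod {n} (suc b * k)) ⟩
    block (suc b * k % n)                ≡⟨ cong block (DivMod.%-congʳ {o = suc b * k} n≡blocks*k) ⟩
    block (suc b * k % (blocks * k))     ≡⟨ cong block (DivMod.m%n*o≡m*o%[n*o] (suc b) blocks k) ⟨
    block (suc b % blocks * k)           ≡⟨ DivMod.m*n/n≡m (suc b % blocks) k ⟩
    suc b % blocks                       ∎
    where open ≡-Reasoning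

  sortedStep-inner : ∀ {b y} → b < blocks → y < k′ → sortedStep (y + b * k) ≡ 0
  sortedStep-inner {b} b<blocks y<k′ =
    trans (cong₂ parityDist (sortedWalk b<blocks (ℕP.m<n⇒m<1+n y<k′)) (sortedWalk b<blocks (s≤s y<k′)))
          (parityDist-refl b)

  sortedStep-boundary : ∀ {b} → b < blocks → sortedStep (k′ + b * k) ≡ 1
  sortedStep-boundary {b} b<blocks =
    trans (cong₂ parityDist (sortedWalk b<blocks ℕP.≤-refl) (sortedWalk-boundary b))
          (parityDist-alternating {b} (trans (parity-%-even (suc b) blocks blocks-even) (parity-suc b)))

  len-sorted : len sortedTour ≡ blocks
  len-sorted = begin
    sumBelow n sortedStep                                                  ≡⟨ cong (λ m → sumBelow m sortedStep) n≡blocks*k ⟩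
    sumBelow (blocks * k) sortedStep                                       ≡⟨ sumBelow-blocks blocks k sortedStep ⟩
    sumBelow blocks (λ b → sumBelow k (λ y → sortedStep (b * k + y)))      ≡⟨ sumBelow-cong blocks oneChangePerBlock ⟩
    sumBelow blocks (λ _ → 1)                                              ≡⟨ sumBelow-const blocks 1 ⟩
    blocks * 1                                                             ≡⟨ ℕP.*-identityʳ blocks ⟩
    blocks                                                                 ∎
    where
    open ≡-Reasoning
    oneChangePerBlock : ∀ b → b < blocks → sumBelow k (λ y → sortedStep (b * k + y)) ≡ 1
    oneChangePerBlock b b<blocks = begin
      sumBelow (suc k′) step                 ≡⟨ sumBelow-last k′ step ⟩
      sumBelow k′ step + step k′             ≡⟨ cong₂ _+_ (sumBelow-cong k′ (λ y y<k′ → trans (cong sortedStep (ℕP.+-comm (b * k) y))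
                                                                                         (sortedStep-inner b<blocks y<k′)))
                                                          (trans (cong sortedStep (ℕP.+-comm (b * k) k′)) (sortedStep-boundary b<blocks)) ⟩
      sumBelow k′ (λ _ → 0) + 1              ≡⟨ cong (_+ 1) (trans (sumBelow-const k′ 0) (ℕP.*-zeroʳ k′)) ⟩
      1                                      ∎
      where
      step : ℕ → ℕ
      step y = sortedStep (b * k + y)

  -- The sorted tour attains the lower bound, hence is a shortest tour.
  sorted-optimal : Optimal I sortedTour
  sorted-optimal T = subst₂ Q._≤_ (sym (tourLength-I sortedTour)) (sym (tourLength-I T))
    (ι-mono-≤ (subst (_≤ len T) (sym len-sorted) (len-lowerBound T)))

  Coords : Set
  Coords = ℕ × ℕ × ℕ

  InRange : Coords → Set
  InRange (t , c , a) = t < 2 × c < k × a < k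

  position : Coords → ℕ
  position (t , c , a) = t + (c + a * k) * 2

  positionCoords : ℕ → Coords
  positionCoords p = p % 2 , (p / 2) % k , (p / 2) / k

  city : Coords → ℕ
  city (s , x , y) = y + (s + x * 2) * k

  cityCoords : ℕ → Coords
  cityCoords r = (r / k) % 2 , (r / k) / 2 , r % k

  k*k*2≡n : k * k * 2 ≡ n
  k*k*2≡n = ℕP.*-comm (k * k) 2

  blocks≡k*2 : blocks ≡ k * 2
  blocks≡k*2 = ℕP.*-comm 2 k

  position-< : ∀ v → InRange v → position v < n
  position-< (t , c , a) (t<2 , c<k , a<k) = subst (position (t , c , a) <_) k*k*2≡n (digits-< t<2 (digits-< c<k a<k))

  city-< : ∀ v → InRange v → city v < n
  city-< (s , x , y) (s<2 , x<k , y<k) =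
    subst (city (s , x , y) <_) (sym n≡blocks*k) (digits-< y<k (subst (s + x * 2 <_) (sym blocks≡k*2) (digits-< s<2 x<k)))

  positionCoords-inRange : ∀ {p} → p < n → InRange (positionCoords p)
  positionCoords-inRange {p} p<n = DivMod.m%n<n p 2 , DivMod.m%n<n (p / 2) k , DivMod.m<n*o⇒m/o<n q<kk
    where
    q<kk : p / 2 < k * k
    q<kk = DivMod.m<n*o⇒m/o<n (subst (p <_) (sym k*k*2≡n) p<n)

  cityCoords-inRange : ∀ {r} → r < n → InRange (cityCoords r)
  cityCoords-inRange {r} r<n =
    DivMod.m%n<n (r / k) 2 , DivMod.m<n*o⇒m/o<n (subst (r / k <_) blocks≡k*2 b<blocks) , DivMod.m%n<n r k
    where
    b<blocks : r / k < blocks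
    b<blocks = DivMod.m<n*o⇒m/o<n (subst (r <_) n≡blocks*k r<n)

  position-positionCoords : ∀ p → position (positionCoords p) ≡ p
  position-positionCoords p = begin
    p % 2 + ((p / 2) % k + (p / 2) / k * k) * 2  ≡⟨ cong (λ q → p % 2 + q * 2) (DivMod.m≡m%n+[m/n]*n (p / 2) k) ⟨
    p % 2 + (p / 2) * 2                          ≡⟨ DivMod.m≡m%n+[m/n]*n p 2 ⟨
    p                                            ∎
    where open ≡-Reasoning

  city-cityCoords : ∀ r → city (cityCoords r) ≡ r
  city-cityCoords r = begin
    r % k + ((r / k) % 2 + (r / k) / 2 * 2) * k  ≡⟨ cong (λ b → r % k + b * k) (DivMod.m≡m%n+[m/n]*n (r / k) 2) ⟨
    r % k + (r / k) * k                          ≡⟨ DivMod.m≡m%n+[m/n]*n r k ⟨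
    r                                            ∎
    where open ≡-Reasoning

  positionCoords-position : ∀ v → InRange v → positionCoords (position v) ≡ v
  positionCoords-position (t , c , a) (t<2 , c<k , a<k)
    rewrite proj₁ (divMod-unique 2 {c + a * k} t<2) | proj₂ (divMod-unique 2 {c + a * k} t<2)
          | proj₁ (divMod-unique k {a} c<k) | proj₂ (divMod-unique k {a} c<k) = refl

  cityCoords-city : ∀ v → InRange v → cityCoords (city v) ≡ v
  cityCoords-city (s , x , y) (s<2 , x<k , y<k)
    rewrite proj₁ (divMod-unique k {s + x * 2} y<k) | proj₂ (divMod-unique k {s + x * 2} y<k)
          | proj₁ (divMod-unique 2 {x} s<2) | proj₂ (divMod-unique 2 {x} s<2) = refl

  block-city : ∀ v → InRange v → block (city v) ≡ proj₁ v + proj₁ (proj₂ v) * 2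
  block-city (s , x , y) (_ , _ , y<k) = block-+* y<k

  -- The zig-zag correspondence between positions and cities: position (0, c, a)
  -- holds city a of block 2c, and position (1, c, a) holds city c of block 2a + 1.
  zigzag : Coords → Coords
  zigzag (zero  , c , a) = zero  , c , a
  zigzag (suc t , c , a) = suc t , a , c

  zigzag-involutive : ∀ v → zigzag (zigzag v) ≡ v
  zigzag-involutive (zero  , c , a) = refl
  zigzag-involutive (suc t , c , a) = refl

  zigzag-inRange : ∀ v → InRange v → InRange (zigzag v)
  zigzag-inRange (zero  , c , a) (t<2 , c<k , a<k) = t<2 , c<k , a<k
  zigzag-inRange (suc t , c , a) (t<2 , c<k , a<k) = t<2 , a<k , c<k

  zigzagMaps : InverseMapsBelow n
  zigzagMaps = record
    { to      = city ∘ zigzag ∘ positionCoords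
    ; from    = position ∘ zigzag ∘ cityCoords
    ; to-<    = λ p<n → city-< _ (zigzag-inRange _ (positionCoords-inRange p<n))
    ; from-<  = λ r<n → position-< _ (zigzag-inRange _ (cityCoords-inRange r<n))
    ; from-to = λ {p} p<n → begin
        position (zigzag (cityCoords (city (zigzag (positionCoords p)))))
          ≡⟨ cong (position ∘ zigzag) (cityCoords-city _ (zigzag-inRange _ (positionCoords-inRange p<n))) ⟩
        position (zigzag (zigzag (positionCoords p)))
          ≡⟨ cong position (zigzag-involutive (positionCoords p)) ⟩
        position (positionCoords p)
          ≡⟨ position-positionCoords p ⟩
        p ∎
    ; to-from = λ {r} r<n → begin
        city (zigzag (positionCoords (position (zigzag (cityCoords r)))))
          ≡⟨ cong (city ∘ zigzag) (positionCoords-position _ (zigzag-inRange _ (cityCoords-inRange r<n))) ⟩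
        city (zigzag (zigzag (cityCoords r)))
          ≡⟨ cong city (zigzag-involutive (cityCoords r)) ⟩
        city (cityCoords r)
          ≡⟨ city-cityCoords r ⟩
        r ∎
    }
    where open ≡-Reasoning

  zigzagTour : Tour n
  zigzagTour = toPermutation zigzagMaps

  zigzagBlock : ℕ → ℕ
  zigzagBlock p = block (city (zigzag (positionCoords p)))

  zigzagTour-block : ∀ i → block (toℕ (zigzagTour ⟨$⟩ʳ i)) ≡ zigzagBlock (toℕ i)
  zigzagTour-block i = cong block (toPermutation-toℕ zigzagMaps i)

  zigzagBlock-parity : ∀ {p} → p < n → parity (zigzagBlock p) ≡ parity p
  zigzagBlock-parity {p} p<n = begin
    parity (zigzagBlock p)                         ≡⟨ cong parity (block-city _ (zigzag-inRange _ (positionCoords-inRange p<n))) ⟩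
    parity (proj₁ v + proj₁ (proj₂ v) * 2)        ≡⟨ parity-+even (proj₁ v) (proj₁ (proj₂ v)) 2 refl ⟩
    parity (proj₁ v)                               ≡⟨ cong parity (zigzag-fst (positionCoords p)) ⟩
    parity (p % 2)                                 ≡⟨ parity-%-even p 2 refl ⟩
    parity p                                       ∎
    where
    open ≡-Reasoning
    v : Coords
    v = zigzag (positionCoords p)
    zigzag-fst : ∀ w → proj₁ (zigzag w) ≡ proj₁ w
    zigzag-fst (zero  , _) = refl
    zigzag-fst (suc _ , _) = refl

  zigzag-alternates : ∀ m → parity (zigzagBlock (suc m % n)) ≡ parity (zigzagBlock (m % n)) ⁻¹
  zigzag-alternates m = begin
    parity (zigzagBlock (suc m % n))   ≡⟨ zigzagBlock-parity (DivMod.m%n<n (suc m) n) ⟩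
    parity (suc m % n)                 ≡⟨ parity-%-even (suc m) n n-even ⟩
    parity (suc m)                     ≡⟨ parity-suc m ⟩
    parity m ⁻¹                        ≡⟨ cong _⁻¹ (parity-%-even m n n-even) ⟨
    parity (m % n) ⁻¹                  ≡⟨ cong _⁻¹ (zigzagBlock-parity (DivMod.m%n<n m n)) ⟨
    parity (zigzagBlock (m % n)) ⁻¹    ∎
    where
    open ≡-Reasoning
    n-even : parity n ≡ 0ℙ
    n-even = ℙP.*-homo-* 2 (k * k)

  zigzag-walk : ∀ m → walk zigzagTour m ≡ zigzagBlock (m % n)
  zigzag-walk m = trans (zigzagTour-block (m mod n)) (cong zigzagBlock (toℕ-mod {n} m))

  -- Every step of the zig-zag tour changes parity, so costs 1: its length is n.
  len-zigzag : len zigzagTour ≡ n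
  len-zigzag = trans (sumBelow-cong n (λ m _ → unitStep m)) (trans (sumBelow-const n 1) (ℕP.*-identityʳ n))
    where
    unitStep : ∀ m → parityDist (walk zigzagTour m) (walk zigzagTour (suc m)) ≡ 1
    unitStep m = trans (cong₂ parityDist (zigzag-walk m) (zigzag-walk (suc m)))
                       (parityDist-alternating {zigzagBlock (m % n)} (zigzag-alternates m))

  *2-injective : ∀ {a b} → a * 2 ≡ b * 2 → a ≡ b
  *2-injective {a} {b} = ℕP.*-cancelʳ-≡ a b 2

  even≢odd : ∀ {a b} → a * 2 ≢ 1 + b * 2
  even≢odd {a} {b} eq = ℙP.p≢p⁻¹ 0ℙ (begin
    0ℙ                  ≡⟨ parity-+even 0 a 2 refl ⟨
    parity (a * 2)      ≡⟨ cong parity eq ⟩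
    parity (1 + b * 2)  ≡⟨ parity-+even 1 b 2 refl ⟩
    1ℙ                  ∎)
    where open ≡-Reasoning

  digits-injective : ∀ {q q′} → q % k ≡ q′ % k → q / k ≡ q′ / k → q ≡ q′
  digits-injective {q} {q′} rem quot = trans (DivMod.m≡m%n+[m/n]*n q k)
    (trans (cong₂ (λ r d → r + d * k) rem quot) (sym (DivMod.m≡m%n+[m/n]*n q′ k)))

  data PositionView : ℕ → Set where
    evenPosition : ∀ {q} → q < k * k → PositionView (q * 2)
    oddPosition  : ∀ {q} → q < k * k → PositionView (1 + q * 2)

  positionView : ∀ {p} → p < n → PositionView p
  positionView {p} p<n = subst PositionView (sym (DivMod.m≡m%n+[m/n]*n p 2)) (byRemainder (p % 2) (DivMod.m%n<n p 2))
    where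
    q<kk : p / 2 < k * k
    q<kk = DivMod.m<n*o⇒m/o<n (subst (p <_) (sym k*k*2≡n) p<n)
    byRemainder : ∀ t → t < 2 → PositionView (t + p / 2 * 2)
    byRemainder 0 _ = evenPosition q<kk
    byRemainder 1 _ = oddPosition q<kk
    byRemainder (suc (suc _)) (s≤s (s≤s ()))

  zigzagBlock-digits : ∀ {t q} → t < 2 → q < k * k →
    zigzagBlock (t + q * 2) ≡ block (city (zigzag (t , q % k , q / k)))
  zigzagBlock-digits {t} {q} t<2 q<kk = cong (block ∘ city ∘ zigzag) (begin
    positionCoords (t + q * 2)                              ≡⟨ cong (λ q′ → positionCoords (t + q′ * 2)) (DivMod.m≡m%n+[m/n]*n q k) ⟩
    positionCoords (position (t , q % k , q / k))           ≡⟨ positionCoords-position _ (t<2 , DivMod.m%n<n q k , DivMod.m<n*o⇒m/o<n q<kk) ⟩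
    (t , q % k , q / k)                                     ∎)
    where open ≡-Reasoning

  zigzagBlock-even : ∀ {q} → q < k * k → zigzagBlock (q * 2) ≡ q % k * 2
  zigzagBlock-even {q} q<kk = trans (zigzagBlock-digits (s≤s z≤n) q<kk)
    (block-+* (DivMod.m<n*o⇒m/o<n q<kk))

  zigzagBlock-odd : ∀ {q} → q < k * k → zigzagBlock (1 + q * 2) ≡ 1 + q / k * 2
  zigzagBlock-odd {q} q<kk = trans (zigzagBlock-digits (s≤s (s≤s z≤n)) q<kk) (block-+* (DivMod.m%n<n q k))

  zigzagBlock-afterEven : ∀ {q} → q < k * k → zigzagBlock (suc (q * 2) % n) ≡ 1 + q / k * 2
  zigzagBlock-afterEven {q} q<kk = trans (cong zigzagBlock (DivMod.m<n⇒m%n≡m 1+q*2<n)) (zigzagBlock-odd q<kk)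
    where
    1+q*2<n : 1 + q * 2 < n
    1+q*2<n = subst (1 + q * 2 <_) k*k*2≡n (digits-< (s≤s (s≤s z≤n)) q<kk)

  zigzagBlock-afterOdd : ∀ {q} → q < k * k → zigzagBlock (suc (1 + q * 2) % n) ≡ suc q % k * 2
  zigzagBlock-afterOdd {q} q<kk = begin
    zigzagBlock (suc q * 2 % n)              ≡⟨ cong zigzagBlock (DivMod.%-congʳ {o = suc q * 2} (sym k*k*2≡n)) ⟩
    zigzagBlock (suc q * 2 % (k * k * 2))    ≡⟨ cong zigzagBlock (DivMod.m%n*o≡m*o%[n*o] (suc q) (k * k) 2) ⟨
    zigzagBlock (suc q % (k * k) * 2)        ≡⟨ zigzagBlock-even (DivMod.m%n<n (suc q) (k * k)) ⟩
    suc q % (k * k) % k * 2                  ≡⟨ cong (_* 2) (DivMod.m∣n⇒o%n%m≡o%m k (k * k) (suc q) (divides k refl)) ⟩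
    suc q % k * 2                            ∎
    where open ≡-Reasoning

  zigzagEdge-injective : ∀ {p p′} → p < n → p′ < n → zigzagBlock p ≡ zigzagBlock p′ →
    zigzagBlock (suc p % n) ≡ zigzagBlock (suc p′ % n) → p ≡ p′
  zigzagEdge-injective p<n p′<n same same⁺ with positionView p<n | positionView p′<n
  ... | evenPosition {q} q<kk | evenPosition {q′} q′<kk = cong (_* 2) (digits-injective {q} {q′}
        (*2-injective {q % k} (trans (sym (zigzagBlock-even q<kk)) (trans same (zigzagBlock-even q′<kk))))
        (*2-injective {q / k} (ℕP.suc-injective (trans (sym (zigzagBlock-afterEven q<kk)) (trans same⁺ (zigzagBlock-afterEven q′<kk))))))
  ... | oddPosition {q} q<kk | oddPosition {q′} q′<kk = cong (λ r → 1 + r * 2) (digits-injective {q} {q′}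
        (suc-mod-injective k′ (*2-injective {suc q % k} (trans (sym (zigzagBlock-afterOdd q<kk)) (trans same⁺ (zigzagBlock-afterOdd q′<kk)))))
        (*2-injective {q / k} (ℕP.suc-injective (trans (sym (zigzagBlock-odd q<kk)) (trans same (zigzagBlock-odd q′<kk))))))
  ... | evenPosition {q} q<kk | oddPosition {q′} q′<kk =
        ⊥-elim (even≢odd {q % k} {q′ / k} (trans (sym (zigzagBlock-even q<kk)) (trans same (zigzagBlock-odd q′<kk))))
  ... | oddPosition {q} q<kk | evenPosition {q′} q′<kk =
        ⊥-elim (even≢odd {q′ % k} {q / k} (trans (sym (zigzagBlock-even q′<kk)) (trans (sym same) (zigzagBlock-odd q<kk))))

  -- Two different edges of the zig-zag tour join four blocks in a pattern that
  -- admits no shortcut, so no 2-change is improving.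
  zigzag-twoOptimal : TwoOptimal I zigzagTour
  zigzag-twoOptimal i j i≢j improving = QP.<-irrefl refl (QP.<-≤-trans reconnected<2 (ι-mono-≤ noShortcut))
    where
    b b⁺ : Fin n → ℕ
    b  i = zigzagBlock (toℕ i)
    b⁺ i = zigzagBlock (suc (toℕ i) % n)

    at : ∀ i → block (toℕ (zigzagTour ⟨$⟩ʳ i)) ≡ b i
    at = zigzagTour-block

    after : ∀ i → block (toℕ (zigzagTour ⟨$⟩ʳ next i)) ≡ b⁺ i
    after i = trans (zigzagTour-block (next i)) (cong zigzagBlock (toℕ-mod {n} (suc (toℕ i))))

    alternates : ∀ i → parity (b⁺ i) ≡ parity (b i) ⁻¹
    alternates i = trans (zigzag-alternates (toℕ i))
      (cong (λ r → parity (zigzagBlock r) ⁻¹) (DivMod.m<n⇒m%n≡m (FinP.toℕ<n i)))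

    unitEdge : ∀ i → ι (parityDist (block (toℕ (zigzagTour ⟨$⟩ʳ i))) (block (toℕ (zigzagTour ⟨$⟩ʳ next i)))) ≡ ι 1
    unitEdge i = cong ι (trans (cong₂ parityDist (at i) (after i)) (parityDist-alternating {b i} (alternates i)))

    reconnected<2 : ι (parityDist (b i) (b j) + parityDist (b⁺ i) (b⁺ j)) Q.< ι 2
    reconnected<2 = subst₂ Q._<_
      (trans (cong₂ Q._+_ (cong ι (cong₂ parityDist (at i) (at j))) (cong ι (cong₂ parityDist (after i) (after j))))
             (sym (ι-+ (parityDist (b i) (b j)) _)))
      (trans (cong₂ Q._+_ (unitEdge i) (unitEdge j)) (sym (ι-+ 1 1)))
      improving

    noShortcut : 2 ≤ parityDist (b i) (b j) + parityDist (b⁺ i) (b⁺ j)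
    noShortcut = parityDist-noShortcut (alternates i) (alternates j) λ (same , same⁺) →
      i≢j (FinP.toℕ-injective (zigzagEdge-injective (FinP.toℕ<n i) (FinP.toℕ<n j) same same⁺))

  sortedTour-length : tourLength I sortedTour ≡ ι blocks
  sortedTour-length = trans (tourLength-I sortedTour) (cong ι len-sorted)

  zigzagTour-length : tourLength I zigzagTour ≡ ι n
  zigzagTour-length = trans (tourLength-I zigzagTour) (cong ι len-zigzag)

theorem3 : (k : ℕ) → 1 ≤ k →
    Σ (MetricInstance (2 * (k * k))) λ I →
    Σ (Tour (2 * (k * k))) λ T →
    Σ (Tour (2 * (k * k))) λ T* →
    TwoOptimal I T × Optimal I T* × (Q.0ℚ Q.< tourLength I T*) ×
    (tourLength I T ≡ (+ k Q./ 1) Q.* tourLength I T*)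
theorem3 (suc k′) _ = I , zigzagTour , sortedTour , zigzag-twoOptimal , sorted-optimal , positive , ratio
  where
  open Construction k′
  open ≡-Reasoning

  positive : Q.0ℚ Q.< tourLength I sortedTour
  positive = subst (Q.0ℚ Q.<_) (sym sortedTour-length) (ι-mono-< (ℕP.<-trans (s≤s z≤n) 2≤blocks))

  ratio : tourLength I zigzagTour ≡ ι k Q.* tourLength I sortedTour
  ratio = begin
    tourLength I zigzagTour          ≡⟨ zigzagTour-length ⟩
    ι n                              ≡⟨ cong ι (trans n≡blocks*k (ℕP.*-comm blocks k)) ⟩
    ι (k * blocks)                   ≡⟨ ι-* k blocks ⟩
    ι k Q.* ι blocks                 ≡⟨ cong (ι k Q.*_) sortedTour-length ⟨
    ι k Q.* tourLength I sortedTour  ∎
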